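{- Let $G=(V,E)$ be a graph with positive edge lengths, $k\in\mathbb{N}$, and let $\rho$ be the optimum cost of the $k$-Center problem on $G$. If a shortest path cover $\mathrm{SPC}(\rho/2)$ of $G$ for scale $\rho/2$ is locally $s$-sparse, then $|\mathrm{SPC}(\rho/2)|\le ks$.
   Context: $\mathrm{dist}_G$ is the shortest-path distance and $B_v(r)=\{u\in V\mid\mathrm{dist}_G(u,v)\le r\}$. The $k$-Center problem: find $C\subseteq V$ with $|C|\le k$ minimizing the smallest $\rho$ with $\bigcup_{v\in C}B_v(\rho)=V$. A shortest path cover $\mathrm{SPC}(r)$ for scale $r$ is a vertex set intersecting every shortest path of length in $(r,2r]$; it is locally $s$-sparse if every ball $B_v(2r)$, $v\in V$, contains at most $s$ of its vertices.
   Formalization: The edge lengths are positive rationals, so the distances, the optimum cost ρ and the scale ρ/2 are rational as well. -}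

module Defs where

open import Data.Nat using (ℕ)
open import Data.Fin using (Fin)
open import Data.Fin.Subset using (Subset; _⊆_; ∣_∣) renaming (_∈_ to _∈ₛ_)
open import Data.Maybe using (Maybe; just)
open import Data.List using (List; []; _∷_)
open import Data.List.Membership.Propositional using (_∈_)
open import Data.Rational using (ℚ; 0ℚ; ½; _+_; _*_; _≤_; _<_)
open import Data.Product using (Σ; ∃; _×_)
open import Relation.Binary.PropositionalEquality using (_≡_)

-- A finite undirected graph on vertex set Fin n with positive edge lengths.
-- len u v ≡ just q  means there is an edge {u,v} of length q.
record Graph : Set where
  field
    n        : ℕ
    len      : Fin n → Fin n → Maybe ℚ
    symm     : ∀ u v → len u v ≡ len v u
    positive : ∀ u v q → len u v ≡ just q → 0ℚ < q

module _ (G : Graph) where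
  open Graph G

  data Walk : Fin n → Fin n → Set where
    here : ∀ {v} → Walk v v
    step : ∀ {u x v} (q : ℚ) → len u x ≡ just q → Walk x v → Walk u v

  walkLength : ∀ {u v} → Walk u v → ℚ
  walkLength here          = 0ℚ
  walkLength (step q _ w)  = q + walkLength w

  vertices : ∀ {u v} → Walk u v → List (Fin n)
  vertices {u} here        = u ∷ []
  vertices {u} (step _ _ w) = u ∷ vertices w

  IsDist : Fin n → Fin n → ℚ → Set
  IsDist u v d = (Σ (Walk u v) λ P → walkLength P ≡ d)
               × (∀ (P : Walk u v) → d ≤ walkLength P)

  -- u ∈ B_v(r)  (dist_G(u,v) ≤ r; false if u,v disconnected)
  InBall : Fin n → ℚ → Fin n → Set
  InBall v r u = Σ ℚ λ d → IsDist u v d × d ≤ r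

  Covers : Subset n → ℚ → Set
  Covers C ρ = ∀ u → Σ (Fin n) λ c → c ∈ₛ C × InBall c ρ u

  IsOptKCenter : ℕ → ℚ → Set
  IsOptKCenter k ρ = (Σ (Subset n) λ C → ∣ C ∣ Data.Nat.≤ k × Covers C ρ)
                   × (∀ (C : Subset n) (ρ' : ℚ) → ∣ C ∣ Data.Nat.≤ k → Covers C ρ' → ρ ≤ ρ')

  IsShortestPath : ∀ {a b} → Walk a b → Set
  IsShortestPath {a} {b} P = IsDist a b (walkLength P)

  IsSPC : ℚ → Subset n → Set
  IsSPC r S = ∀ {a b} (P : Walk a b) → IsShortestPath P
            → r < walkLength P → walkLength P ≤ r + r
            → Σ (Fin n) λ x → x ∈ vertices P × x ∈ₛ S

  LocallySparse : ℚ → ℕ → Subset n → Set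
  LocallySparse r s S = ∀ (v : Fin n) (T : Subset n) → T ⊆ S
                      → (∀ u → u ∈ₛ T → InBall v (r + r) u) → ∣ T ∣ Data.Nat.≤ s

-- Give every vertex a centre of an optimal k-center solution whose ball of radius
-- ρ = ρ/2 + ρ/2 contains it. The vertices of S sharing a centre c lie in B_c(2 · ρ/2),
-- so local sparsity allows at most s of them, and there are at most k centres.

{-# OPTIONS --safe #-}
module Submission where

open import Defs
open import Data.Nat using (ℕ; _+_; _*_; _≤_; z≤n; s≤s)
open import Data.Nat.Properties
  using (≤-trans; ≤-reflexive; +-suc; +-monoʳ-≤; +-mono-≤; n≤1+n; *-monoˡ-≤; module ≤-Reasoning)
open import Data.Rational using (ℚ; ½) renaming (_*_ to _*ℚ_; _+_ to _+ℚ_)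
open import Data.Rational.Properties using (*-distribʳ-+; *-identityˡ)
open import Data.Fin using (Fin; zero; suc; _≟_)
open import Data.Fin.Subset using (Subset; ∣_∣; _∈_; _⊆_; _∪_; _∩_; ⊥; inside; outside)
open import Data.Fin.Subset.Properties
  using (∣⊥∣≡0; p⊆p∪q; q⊆p∪q; p∩q⊆p; x∈p∩q⁺; x∈p∩q⁻; p⊆q⇒∣p∣≤∣q∣)
open import Data.Vec using ([]; _∷_; here; there; tabulate)
open import Data.Vec.Properties using (lookup∘tabulate; lookup⇒[]=; []=⇒lookup)
open import Data.Product using (_,_; proj₁; proj₂)
open import Function using (_∘_)
open import Relation.Nullary using (yes; no; does)
open import Relation.Nullary.Decidable using (dec-true)
open import Relation.Binary.PropositionalEquality using (_≡_; refl; sym; trans; subst)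

private
  variable
    m n s : ℕ

∣p∪q∣≤∣p∣+∣q∣ : ∀ (p q : Subset n) → ∣ p ∪ q ∣ ≤ ∣ p ∣ + ∣ q ∣
∣p∪q∣≤∣p∣+∣q∣ []            []            = z≤n
∣p∪q∣≤∣p∣+∣q∣ (outside ∷ p) (outside ∷ q) = ∣p∪q∣≤∣p∣+∣q∣ p q
∣p∪q∣≤∣p∣+∣q∣ (outside ∷ p) (inside  ∷ q) =
  ≤-trans (s≤s (∣p∪q∣≤∣p∣+∣q∣ p q)) (≤-reflexive (sym (+-suc ∣ p ∣ ∣ q ∣)))
∣p∪q∣≤∣p∣+∣q∣ (inside  ∷ p) (outside ∷ q) = s≤s (∣p∪q∣≤∣p∣+∣q∣ p q)
∣p∪q∣≤∣p∣+∣q∣ (inside  ∷ p) (inside  ∷ q) =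
  s≤s (≤-trans (∣p∪q∣≤∣p∣+∣q∣ p q) (+-monoʳ-≤ ∣ p ∣ (n≤1+n ∣ q ∣)))

infix 9 ⋃[_]_

⋃[_]_ : Subset m → (Fin m → Subset n) → Subset n
⋃[ []          ] F = ⊥
⋃[ inside  ∷ q ] F = F zero ∪ ⋃[ q ] (F ∘ suc)
⋃[ outside ∷ q ] F = ⋃[ q ] (F ∘ suc)

⊆-⋃[] : ∀ {q : Subset m} (F : Fin m → Subset n) {y} → y ∈ q → F y ⊆ ⋃[ q ] F
⊆-⋃[] {q = inside  ∷ q} F here        = p⊆p∪q _
⊆-⋃[] {q = inside  ∷ q} F (there y∈q) = λ x∈F → q⊆p∪q (F zero) _ (⊆-⋃[] (F ∘ suc) y∈q x∈F)
⊆-⋃[] {q = outside ∷ q} F (there y∈q) = ⊆-⋃[] (F ∘ suc) y∈q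

∣⋃[q]F∣≤∣q∣*s : ∀ (q : Subset m) (F : Fin m → Subset n) →
                (∀ {y} → y ∈ q → ∣ F y ∣ ≤ s) → ∣ ⋃[ q ] F ∣ ≤ ∣ q ∣ * s
∣⋃[q]F∣≤∣q∣*s {n = n} []            F ∣F∣≤s = ≤-reflexive (∣⊥∣≡0 n)
∣⋃[q]F∣≤∣q∣*s (inside  ∷ q) F ∣F∣≤s = ≤-trans (∣p∪q∣≤∣p∣+∣q∣ (F zero) _)
  (+-mono-≤ (∣F∣≤s here) (∣⋃[q]F∣≤∣q∣*s q (F ∘ suc) (∣F∣≤s ∘ there)))
∣⋃[q]F∣≤∣q∣*s (outside ∷ q) F ∣F∣≤s = ∣⋃[q]F∣≤∣q∣*s q (F ∘ suc) (∣F∣≤s ∘ there)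

fibre : (Fin n → Fin m) → Fin m → Subset n
fibre f y = tabulate (λ x → does (f x ≟ y))

∈-fibre⁺ : ∀ (f : Fin n → Fin m) x → x ∈ fibre f (f x)
∈-fibre⁺ f x = lookup⇒[]= x _ (trans (lookup∘tabulate _ x) (dec-true (f x ≟ f x) refl))

∈-fibre⁻ : ∀ (f : Fin n → Fin m) {x y} → x ∈ fibre f y → f x ≡ y
∈-fibre⁻ f {x} {y} x∈fibre with f x ≟ y | trans (sym (lookup∘tabulate _ x)) ([]=⇒lookup x∈fibre)
... | yes fx≡y | _  = fx≡y
... | no _     | ()

∣p∣≤∣q∣*s-by-fibres : ∀ (f : Fin n → Fin m) {p q} → (∀ {x} → x ∈ p → f x ∈ q) →
                      (∀ {y} → y ∈ q → ∣ p ∩ fibre f y ∣ ≤ s) → ∣ p ∣ ≤ ∣ q ∣ * s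
∣p∣≤∣q∣*s-by-fibres f {p} {q} f[p]⊆q ∣fibres∣≤s = ≤-trans
  (p⊆q⇒∣p∣≤∣q∣ p⊆⋃fibres) (∣⋃[q]F∣≤∣q∣*s q (λ y → p ∩ fibre f y) ∣fibres∣≤s)
  where
  p⊆⋃fibres : p ⊆ ⋃[ q ] (λ y → p ∩ fibre f y)
  p⊆⋃fibres {x} x∈p = ⊆-⋃[] (λ y → p ∩ fibre f y) (f[p]⊆q x∈p) (x∈p∩q⁺ (x∈p , ∈-fibre⁺ f x))

locallySparse⇒∣S∣≤∣C∣*s : ∀ (G : Graph) {C S : Subset (Graph.n G)} {r s} →
                          Covers G C (r +ℚ r) → LocallySparse G r s S → ∣ S ∣ ≤ ∣ C ∣ * s
locallySparse⇒∣S∣≤∣C∣*s G {C} {S} {r} {s} covers sparse =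
  ∣p∣≤∣q∣*s-by-fibres centre {S} {C} (λ {u} _ → proj₁ (proj₂ (covers u))) (λ {c} _ → fibre-bound c)
  where
  centre : Fin (Graph.n G) → Fin (Graph.n G)
  centre u = proj₁ (covers u)

  fibre-in-ball : ∀ c u → u ∈ S ∩ fibre centre c → InBall G c (r +ℚ r) u
  fibre-in-ball c u u∈fibre = subst (λ c′ → InBall G c′ (r +ℚ r) u)
    (∈-fibre⁻ centre (proj₂ (x∈p∩q⁻ S _ u∈fibre))) (proj₂ (proj₂ (covers u)))

  fibre-bound : ∀ c → ∣ S ∩ fibre centre c ∣ ≤ s
  fibre-bound c = sparse c (S ∩ fibre centre c) (p∩q⊆p S _) (fibre-in-ball c)

½*q+½*q≡q : ∀ q → ½ *ℚ q +ℚ ½ *ℚ q ≡ q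
½*q+½*q≡q q = trans (sym (*-distribʳ-+ q ½ ½)) (*-identityˡ q)

lemma5 : (G : Graph) (k s : ℕ) (ρ : ℚ) (S : Subset (Graph.n G))
       → IsOptKCenter G k ρ
       → IsSPC G (½ *ℚ ρ) S
       → LocallySparse G (½ *ℚ ρ) s S
       → ∣ S ∣ ≤ k * s
lemma5 G k s ρ S ((C , ∣C∣≤k , C-covers) , _) _ sparse = begin
  ∣ S ∣      ≤⟨ locallySparse⇒∣S∣≤∣C∣*s G {r = ½ *ℚ ρ} C-covers-at-2·ρ/2 sparse ⟩
  ∣ C ∣ * s  ≤⟨ *-monoˡ-≤ s ∣C∣≤k ⟩
  k * s      ∎
  where
  open ≤-Reasoning
  C-covers-at-2·ρ/2 : Covers G C (½ *ℚ ρ +ℚ ½ *ℚ ρ)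
  C-covers-at-2·ρ/2 = subst (Covers G C) (sym (½*q+½*q≡q ρ)) C-covers
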